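{- Let $\mathbf{a}, \mathbf{c} \in \mathbb{N}^n$ and let $t = (\mathbf{g}, \mathbf{d}) \in \mathbb{N}^n \times \mathbb{Z}^n$ be a Petri net transition. (1) Suppose $\mathbf{c} \preceq \max(\mathbf{a} - \mathbf{d}, \mathbf{g})$. Define $\mathbf{a}'' \in \mathbb{N}^n$ by $a''_j = c_j + d_j$ if $g_j < c_j$ and $a''_j = 0$ if $g_j \ge c_j$, for $j = 1, \ldots, n$. Then $\mathbf{a}'' \preceq \mathbf{a}$, and for every $\mathbf{a}' \in \mathbb{N}^n$ with $\mathbf{a}'' \preceq \mathbf{a}' \preceq \mathbf{a}$ we have $\mathbf{c} \preceq \max(\mathbf{a}' - \mathbf{d}, \mathbf{g})$. (2) If $\mathbf{a} \preceq \max(\mathbf{a} - \mathbf{d}, \mathbf{g})$, then for every $\mathbf{a}' \in \mathbb{N}^n$ with $\mathbf{a}' \preceq \mathbf{a}$ we have $\mathbf{a}' \preceq \max(\mathbf{a}' - \mathbf{d}, \mathbf{g})$.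
   Context: Consider a Petri net with places $s_1, \ldots, s_n$, transitions $T$ and arc multiplicities $W : (S \times T) \cup (T \times S) \to \mathbb{N}$. Markings are vectors in $\mathbb{N}^n$ ordered componentwise by $\preceq$. A transition $t$ is represented as $(\mathbf{g}, \mathbf{d})$ with $g_j = W(s_j, t)$ and $d_j = W(t, s_j) - W(s_j, t)$ (so in particular $d_j \ge -g_j$). $\max$ and $-$ on vectors are taken componentwise. -}

module Defs where

open import Data.Nat using (ℕ)
open import Data.Fin using (Fin)
open import Data.Integer using (ℤ; +_; -_; _+_; _-_; _⊔_; _≤_; 0ℤ)
open import Data.Nat using (_<?_)
open import Relation.Nullary using (yes; no)

Vecℕ : ℕ → Set
Vecℕ n = Fin n → ℕ

Vecℤ : ℕ → Set
Vecℤ n = Fin n → ℤ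

_⪯_ : ∀ {n} → Vecℤ n → Vecℤ n → Set
u ⪯ v = ∀ j → u j ≤ v j

ι : ∀ {n} → Vecℕ n → Vecℤ n
ι a j = + a j

record Transition (n : ℕ) : Set where
  field
    g : Vecℕ n
    d : Vecℤ n
    d≥-g : ∀ j → - (+ g j) ≤ d j
open Transition public

maxPre : ∀ {n} → Vecℕ n → Transition n → Vecℤ n
maxPre a t j = (+ a j - d t j) ⊔ (+ g t j)

a'' : ∀ {n} → Vecℕ n → Transition n → Vecℤ n
a'' c t j with g t j <? c j
... | yes _ = + c j + d t j
... | no _  = 0ℤ

-- The marking a'' c t is the least x ∈ ℕⁿ with c ⪯ max(x − d, g): in a coordinate
-- with g_j < c_j the bound c_j ≤ max(x_j − d_j, g_j) can only hold through its first
-- argument, i.e. it says c_j + d_j ≤ x_j, while otherwise it holds for every x_j.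
-- Part (1) is the two directions of this characterisation.  For part (2), in a
-- coordinate with g_j < a_j the hypothesis forces d_j ≤ 0, so x_j ≤ x_j − d_j for
-- every x_j, and in the remaining coordinates a'_j ≤ a_j ≤ g_j.
module Submission where

open import Defs
open import Data.Nat using (ℕ; z≤n; _<?_; _≤?_)
open import Data.Nat.Properties using (<⇒≤; ≮⇒≥; ≰⇒>)
open import Data.Product using (_×_; _,_)
open import Data.Sum using (inj₁; inj₂)
open import Data.Integer using (+_; -_; _+_; _-_; _⊔_; _≤_; _<_; 0ℤ; +≤+; +<+)
open import Data.Integer.Properties
  using ( ≤-trans; ≤-total; <⇒≱; +-identityʳ; +-monoˡ-≤; +-monoʳ-≤; neg-cancel-≤; i≤j⇒0≤j-i
        ; i≤j⇒i⊔j≡j; i≥j⇒i⊔j≡i; i≤j⇒i≤j⊔k; i≤j⇒i≤k⊔j)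
open import Data.Integer.Tactic.RingSolver using (solve-∀)
open import Relation.Binary.PropositionalEquality using (_≡_; subst)
open import Relation.Nullary using (yes; no; contradiction)

i≤j⊔k⇒k<i⇒i≤j : ∀ {i j k} → i ≤ j ⊔ k → k < i → i ≤ j
i≤j⊔k⇒k<i⇒i≤j {i} {j} {k} i≤j⊔k k<i with ≤-total j k
... | inj₁ j≤k = contradiction (subst (i ≤_) (i≤j⇒i⊔j≡j j≤k) i≤j⊔k) (<⇒≱ k<i)
... | inj₂ k≤j = subst (i ≤_) (i≥j⇒i⊔j≡i k≤j) i≤j⊔k

i≤j-k⇒i+k≤j : ∀ {i j} k → i ≤ j - k → i + k ≤ j
i≤j-k⇒i+k≤j {i} {j} k i≤j-k = subst (i + k ≤_) (j-k+k≡j j k) (+-monoˡ-≤ k i≤j-k)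
  where
  j-k+k≡j : ∀ j k → j - k + k ≡ j
  j-k+k≡j = solve-∀

i+k≤j⇒i≤j-k : ∀ {i j} k → i + k ≤ j → i ≤ j - k
i+k≤j⇒i≤j-k {i} {j} k i+k≤j = subst (_≤ j - k) (i+k-k≡i i k) (+-monoˡ-≤ (- k) i+k≤j)
  where
  i+k-k≡i : ∀ i k → i + k - k ≡ i
  i+k-k≡i = solve-∀

i≤i-k⇒k≤0 : ∀ {i} k → i ≤ i - k → k ≤ 0ℤ
i≤i-k⇒k≤0 {i} k i≤i-k = neg-cancel-≤ (subst (0ℤ ≤_) (i-k-i≡-k i k) (i≤j⇒0≤j-i i≤i-k))
  where
  i-k-i≡-k : ∀ i k → i - k - i ≡ - k
  i-k-i≡-k = solve-∀

k≤0⇒i≤i-k : ∀ i {k} → k ≤ 0ℤ → i ≤ i - k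
k≤0⇒i≤i-k i {k} k≤0 = i+k≤j⇒i≤j-k k (subst (i + k ≤_) (+-identityʳ i) (+-monoʳ-≤ i k≤0))

module _ {n : ℕ} (t : Transition n) where

  a''-nonNegative : ∀ (c : Vecℕ n) j → 0ℤ ≤ a'' c t j
  a''-nonNegative c j with g t j <? c j
  ... | yes g<c = ≤-trans (i≤j⇒0≤j-i (+≤+ (<⇒≤ g<c))) (+-monoʳ-≤ (+ c j) (d≥-g t j))
  ... | no _    = +≤+ z≤n

  covered⇒a''⪯ : ∀ {c x : Vecℕ n} → ι c ⪯ maxPre x t → a'' c t ⪯ ι x
  covered⇒a''⪯ {c} c⪯ j with g t j <? c j
  ... | yes g<c = i≤j-k⇒i+k≤j (d t j) (i≤j⊔k⇒k<i⇒i≤j (c⪯ j) (+<+ g<c))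
  ... | no _    = +≤+ z≤n

  a''⪯⇒covered : ∀ {c x : Vecℕ n} → a'' c t ⪯ ι x → ι c ⪯ maxPre x t
  a''⪯⇒covered {c} a''⪯x j with g t j <? c j | a''⪯x j
  ... | yes _   | c+d≤x = i≤j⇒i≤j⊔k _ (i+k≤j⇒i≤j-k (d t j) c+d≤x)
  ... | no g≮c  | _     = i≤j⇒i≤k⊔j _ (+≤+ (≮⇒≥ g≮c))

  selfCovered-downwardClosed : ∀ {a a' : Vecℕ n} →
    ι a ⪯ maxPre a t → ι a' ⪯ ι a → ι a' ⪯ maxPre a' t
  selfCovered-downwardClosed {a} {a'} a⪯ a'⪯a j with a j ≤? g t j
  ... | yes a≤g = i≤j⇒i≤k⊔j _ (≤-trans (a'⪯a j) (+≤+ a≤g))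
  ... | no a≰g  = i≤j⇒i≤j⊔k _ (k≤0⇒i≤i-k (+ a' j) d≤0)
    where
    d≤0 : d t j ≤ 0ℤ
    d≤0 = i≤i-k⇒k≤0 (d t j) (i≤j⊔k⇒k<i⇒i≤j (a⪯ j) (+<+ (≰⇒> a≰g)))

lemma7 : ∀ {n} (a c : Vecℕ n) (t : Transition n) →
    (ι c ⪯ maxPre a t →
      ((∀ j → 0ℤ ≤ a'' c t j) × (a'' c t ⪯ ι a)) ×
      (∀ (a' : Vecℕ n) → a'' c t ⪯ ι a' → ι a' ⪯ ι a → ι c ⪯ maxPre a' t))
    × (ι a ⪯ maxPre a t →
      ∀ (a' : Vecℕ n) → ι a' ⪯ ι a → ι a' ⪯ maxPre a' t)
-- Minimality of a'' makes the upper bound a' ⪯ a superfluous in part (1).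
lemma7 a c t =
    (λ c⪯ → (a''-nonNegative t c , covered⇒a''⪯ t c⪯) , λ a' a''⪯a' _ → a''⪯⇒covered t a''⪯a')
  , λ a⪯ a' a'⪯a → selfCovered-downwardClosed t a⪯ a'⪯a
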